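{- For all integers $n,r,s$, $$h_{n+s}h_{n-r}-h_nh_{n-r+s}=Eq^{n-r}\left(v_{r+s}-q^sv_{r-s}\right).$$
   Context: Let $a,b,p,q$ be complex numbers with $q\neq 0$. Put $E=b^2-abp+a^2q$. Sequences are indexed by $\mathbb{Z}$, extended to negative indices by solving the recurrence backwards. The sequence $(v_n)$ is defined by $v_0=2$, $v_1=p$, $v_n=pv_{n-1}-qv_{n-2}$. The Horadam-Lucas sequence $(h_n)$ is defined by $h_0=2b-ap$, $h_1=bp-2aq$, $h_n=ph_{n-1}-qh_{n-2}$. -}

module Defs where

open import Level using (Level)
open import Data.Nat using (ℕ; zero; suc)
open import Data.Integer using (ℤ; +_; -[1+_])
open import Data.Product using (_×_; _,_; proj₁)
open import Algebra.Bundles using (CommutativeRing)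

-- Horadam-type sequences over a commutative ring R in which q has a
-- (chosen) inverse qi.  (ℂ is not available in agda-stdlib.)
module Horadam {c ℓ : Level} (R : CommutativeRing c ℓ) where
  open CommutativeRing R

  pow : Carrier → ℕ → Carrier
  pow x zero    = 1#
  pow x (suc k) = pow x k * x

  zpow : (q qi : Carrier) → ℤ → Carrier
  zpow q qi (+ k)      = pow q k
  zpow q qi -[1+ k ]   = pow qi (suc k)

  -- forward: fwd k = (x_k , x_{k+1}) for x_n = p x_{n-1} - q x_{n-2}
  fwd : (p q x0 x1 : Carrier) → ℕ → Carrier × Carrier
  fwd p q x0 x1 zero = x0 , x1
  fwd p q x0 x1 (suc k) with fwd p q x0 x1 k
  ... | (y , z) = z , (p * z - q * y)

  -- backward: bwd k = (x_{-k} , x_{-k+1}), solving x_{n-2} = qi (p x_{n-1} - x_n)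
  bwd : (p qi x0 x1 : Carrier) → ℕ → Carrier × Carrier
  bwd p qi x0 x1 zero = x0 , x1
  bwd p qi x0 x1 (suc k) with bwd p qi x0 x1 k
  ... | (y , z) = qi * (p * y - z) , y

  lucasSeq : (p q qi x0 x1 : Carrier) → ℤ → Carrier
  lucasSeq p q qi x0 x1 (+ k)    = proj₁ (fwd p q x0 x1 k)
  lucasSeq p q qi x0 x1 -[1+ k ] = proj₁ (bwd p qi x0 x1 (suc k))

  v : (p q qi : Carrier) → ℤ → Carrier
  v p q qi = lucasSeq p q qi (1# + 1#) p

  h : (a b p q qi : Carrier) → ℤ → Carrier
  h a b p q qi = lucasSeq p q qi ((1# + 1#) * b - a * p) (b * p - (1# + 1#) * (a * q))

  E : (a b p q : Carrier) → Carrier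
  E a b p q = b * b - a * b * p + a * a * q

-- Write t = -r.  As functions of s and of t, both sides of the identity solve the
-- recurrence x(k+2) = p x(k+1) - q x(k): the left side because h does, the right side
-- because v does and k ↦ q^(a+k) x(b-k) is a solution whenever x is.  Since q is
-- invertible, a solution on ℤ is determined by two consecutive values, so it suffices to
-- compare the two sides for s, t ∈ {0, 1}.  Three of these cases are immediate; the
-- fourth is Cassini's identity h(n+1)² - h(n) h(n+2) = qⁿ (h(1)² - h(0) h(2)) = qⁿ E (4q - p²).
module Submission where

open import Defs
open import Level using (Level)
open import Data.Integer using (ℤ) renaming (_+_ to _+ℤ_; _-_ to _-ℤ_)
open import Algebra.Bundles using (CommutativeRing)
open import Data.Integer.Base using (+_; -[1+_]; _⊖_) renaming (_*_ to _*ℤ_; -_ to -ℤ_)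
import Data.Integer.Base as ℤ
import Data.Integer.Properties as ℤ
import Data.Nat.Properties as ℕ
open import Data.Integer.Tactic.RingSolver using (solve-∀)
open import Data.Nat.Base using (suc) renaming (_+_ to _+ℕ_)
open import Data.Maybe.Base using (Maybe; map)
open import Function.Base using (_∘_)
open import Relation.Binary.Consequences using (dec⇒weaklyDec)
open import Relation.Binary.PropositionalEquality using (_≡_; cong; cong₂)
  renaming (refl to ≡-refl; trans to ≡-trans)
import Algebra.Solver.Ring
open import Algebra.Solver.Ring.AlmostCommutativeRing
  using (fromCommutativeRing; _-Raw-AlmostCommutative⟶_)

-- Stated with + 1 +ℤ_ rather than ℤ.suc, which solve-∀ does not unfold.
+-suc : ∀ a k → a +ℤ (+ 1 +ℤ k) ≡ + 1 +ℤ (a +ℤ k)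
+-suc = solve-∀

sub-suc : ∀ b k → b -ℤ k ≡ + 1 +ℤ (b -ℤ (+ 1 +ℤ k))
sub-suc = solve-∀

-- The reflective ring solver needs decidable equality on the ring itself; with ℤ as
-- coefficient ring, mapped into R, the solver of Algebra.Solver.Ring works in every
-- commutative ring.
module IntegerCoefficientSolver {c ℓ : Level} (R : CommutativeRing c ℓ) where
  open CommutativeRing R
  open import Algebra.Properties.Ring ring using (-‿distribˡ-*; -0#≈0#; -‿involutive; -‿+-comm)
  open import Algebra.Properties.CommutativeSemigroup +-commutativeSemigroup using (interchange)
  open import Algebra.Properties.Semiring.Mult.TCOptimised semiring using (_×_; ×-homo-+)
  open import Relation.Binary.Reasoning.Setoid setoid

  fromℤ : ℤ → Carrier
  fromℤ (+ n)    = n × 1#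
  fromℤ -[1+ n ] = - (suc n × 1#)

  fromℤ-⊖ : ∀ m n → fromℤ (m ⊖ n) ≈ m × 1# - n × 1#
  fromℤ-⊖ m       0       = sym (trans (+-congˡ -0#≈0#) (+-identityʳ _))
  fromℤ-⊖ 0       (suc n) = sym (+-identityˡ _)
  fromℤ-⊖ (suc m) (suc n) = begin
    fromℤ (suc m ⊖ suc n)    ≡⟨ cong fromℤ (ℤ.[1+m]⊖[1+n]≡m⊖n m n) ⟩
    fromℤ (m ⊖ n)            ≈⟨ fromℤ-⊖ m n ⟩
    x - y                    ≈⟨ +-identityˡ _ ⟨
    0# + (x - y)             ≈⟨ +-congʳ (-‿inverseʳ 1#) ⟨
    (1# + - 1#) + (x + - y)  ≈⟨ interchange 1# (- 1#) x (- y) ⟩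
    (1# + x) + (- 1# + - y)  ≈⟨ +-congˡ (-‿+-comm 1# y) ⟩
    (1# + x) - (1# + y)      ≈⟨ +-cong (×-homo-+ 1# 1 m) (-‿cong (×-homo-+ 1# 1 n)) ⟨
    suc m × 1# - suc n × 1#  ∎
    where
    x y : Carrier
    x = m × 1#
    y = n × 1#

  +-homo : ∀ i j → fromℤ (i ℤ.+ j) ≈ fromℤ i + fromℤ j
  +-homo (+ m)    (+ n)    = ×-homo-+ 1# m n
  +-homo (+ m)    -[1+ n ] = fromℤ-⊖ m (suc n)
  +-homo -[1+ m ] (+ n)    = trans (fromℤ-⊖ n (suc m)) (+-comm _ _)
  +-homo -[1+ m ] -[1+ n ] = begin
    - (suc (suc (m +ℕ n)) × 1#)      ≡⟨ cong (λ k → - (suc k × 1#)) (ℕ.+-suc m n) ⟨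
    - ((suc m +ℕ suc n) × 1#)        ≈⟨ -‿cong (×-homo-+ 1# (suc m) (suc n)) ⟩
    - (suc m × 1# + suc n × 1#)      ≈⟨ -‿+-comm _ _ ⟨
    - (suc m × 1#) + - (suc n × 1#)  ∎

  -‿homo : ∀ i → fromℤ (-ℤ i) ≈ - fromℤ i
  -‿homo (+ 0)     = sym -0#≈0#
  -‿homo (+ suc n) = refl
  -‿homo -[1+ n ]  = sym (-‿involutive _)

  *-homo⁺ : ∀ m j → fromℤ (+ m *ℤ j) ≈ fromℤ (+ m) * fromℤ j
  *-homo⁺ 0       j = trans (reflexive (cong fromℤ (ℤ.*-zeroˡ j))) (sym (zeroˡ _))
  *-homo⁺ (suc m) j = begin
    fromℤ (+ suc m *ℤ j)                  ≡⟨ cong fromℤ (ℤ.suc-* (+ m) j) ⟩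
    fromℤ (j ℤ.+ + m *ℤ j)                ≈⟨ +-homo j (+ m *ℤ j) ⟩
    fromℤ j + fromℤ (+ m *ℤ j)            ≈⟨ +-congˡ (*-homo⁺ m j) ⟩
    fromℤ j + fromℤ (+ m) * fromℤ j       ≈⟨ +-congʳ (*-identityˡ _) ⟨
    1# * fromℤ j + fromℤ (+ m) * fromℤ j  ≈⟨ distribʳ _ _ _ ⟨
    (1# + fromℤ (+ m)) * fromℤ j          ≈⟨ *-congʳ (×-homo-+ 1# 1 m) ⟨
    fromℤ (+ suc m) * fromℤ j             ∎

  *-homo : ∀ i j → fromℤ (i *ℤ j) ≈ fromℤ i * fromℤ j
  *-homo (+ m)    j = *-homo⁺ m j
  *-homo -[1+ m ] j = begin
    fromℤ (-[1+ m ] *ℤ j)          ≡⟨ cong fromℤ (ℤ.neg-distribˡ-* (+ suc m) j) ⟨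
    fromℤ (-ℤ (+ suc m *ℤ j))      ≈⟨ -‿homo (+ suc m *ℤ j) ⟩
    - fromℤ (+ suc m *ℤ j)         ≈⟨ -‿cong (*-homo⁺ (suc m) j) ⟩
    - (fromℤ (+ suc m) * fromℤ j)  ≈⟨ -‿distribˡ-* _ _ ⟩
    fromℤ -[1+ m ] * fromℤ j       ∎

  homomorphism : ℤ.+-*-rawRing -Raw-AlmostCommutative⟶ fromCommutativeRing R
  homomorphism = record
    { ⟦_⟧ = fromℤ ; +-homo = +-homo ; *-homo = *-homo ; -‿homo = -‿homo
    ; 0-homo = refl ; 1-homo = refl }

  fromℤ-weaklyDec : ∀ i j → Maybe (fromℤ i ≈ fromℤ j)
  fromℤ-weaklyDec i j = map (λ { ≡-refl → refl }) (dec⇒weaklyDec ℤ._≟_ i j)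

  open Algebra.Solver.Ring ℤ.+-*-rawRing (fromCommutativeRing R) homomorphism fromℤ-weaklyDec public

module Recurrence {c ℓ : Level} (R : CommutativeRing c ℓ) where
  open CommutativeRing R
  open Horadam R
  open IntegerCoefficientSolver R using (solve; _:=_; _:+_; _:*_; _:-_; :-_; con)
  open import Relation.Binary.Reasoning.Setoid setoid

  module Solutions (p q qi : Carrier) (q*qi≈1 : q * qi ≈ 1#) where

    ≈-modulo-q*qi-1 : ∀ {x y} z → x ≈ y + (q * qi - 1#) * z → x ≈ y
    ≈-modulo-q*qi-1 {x} {y} z x≈y+[q*qi-1]z = begin
      x                      ≈⟨ x≈y+[q*qi-1]z ⟩
      y + (q * qi - 1#) * z  ≈⟨ +-congˡ (*-congʳ (+-congʳ q*qi≈1)) ⟩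
      y + (1# - 1#) * z      ≈⟨ solve 2 (λ y z → y :+ (con (+ 1) :- con (+ 1)) :* z := y) refl y z ⟩
      y                      ∎

    q^_ : ℤ → Carrier
    q^_ = zpow q qi

    q^-suc : ∀ k → q^ ℤ.suc k ≈ q^ k * q
    q^-suc (+ k)        = refl
    q^-suc -[1+ 0 ]     = sym (≈-modulo-q*qi-1 1#
      (solve 2 (λ q qi → con (+ 1) :* qi :* q := con (+ 1) :+ (q :* qi :- con (+ 1)) :* con (+ 1)) refl q qi))
    q^-suc -[1+ suc m ] = sym (≈-modulo-q*qi-1 (pow qi (suc m))
      (solve 3 (λ x q qi → x :* qi :* q := x :+ (q :* qi :- con (+ 1)) :* x) refl (pow qi (suc m)) q qi))

    geometric : ∀ {x : ℤ → Carrier} → (∀ k → x (ℤ.suc k) ≈ q * x k) → ∀ k → x k ≈ q^ k * x (+ 0)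
    geometric {x} step = go
      where
      forward : ∀ k → x k ≈ q^ k * x (+ 0) → x (ℤ.suc k) ≈ q^ ℤ.suc k * x (+ 0)
      forward k hyp = begin
        x (ℤ.suc k)            ≈⟨ step k ⟩
        q * x k                ≈⟨ *-congˡ hyp ⟩
        q * (q^ k * x (+ 0))   ≈⟨ solve 3 (λ q y z → q :* (y :* z) := y :* q :* z) refl q (q^ k) (x (+ 0)) ⟩
        q^ k * q * x (+ 0)     ≈⟨ *-congʳ (q^-suc k) ⟨
        q^ ℤ.suc k * x (+ 0)   ∎

      backward : ∀ k → x (ℤ.suc k) ≈ q^ ℤ.suc k * x (+ 0) → x k ≈ q^ k * x (+ 0)
      backward k hyp = begin
        x k
          ≈⟨ ≈-modulo-q*qi-1 (- x k)
               (solve 3 (λ q qi y → y := qi :* (q :* y) :+ (q :* qi :- con (+ 1)) :* (:- y)) refl q qi (x k)) ⟩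
        qi * (q * x k)
          ≈⟨ *-congˡ (step k) ⟨
        qi * x (ℤ.suc k)
          ≈⟨ *-congˡ (trans hyp (*-congʳ (q^-suc k))) ⟩
        qi * (q^ k * q * x (+ 0))
          ≈⟨ ≈-modulo-q*qi-1 (q^ k * x (+ 0))
               (solve 4 (λ q qi y z → qi :* (y :* q :* z) := y :* z :+ (q :* qi :- con (+ 1)) :* (y :* z))
                      refl q qi (q^ k) (x (+ 0))) ⟩
        q^ k * x (+ 0)
          ∎

      go : ∀ k → x k ≈ q^ k * x (+ 0)
      go (+ 0)        = sym (*-identityˡ _)
      go (+ suc k)    = forward (+ k) (go (+ k))
      go -[1+ 0 ]     = backward -[1+ 0 ] (go (+ 0))
      go -[1+ suc m ] = backward -[1+ suc m ] (go -[1+ m ])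

    Recurrent : (ℤ → Carrier) → Set ℓ
    Recurrent x = ∀ k → x (ℤ.suc (ℤ.suc k)) ≈ p * x (ℤ.suc k) - q * x k

    backward-step-correct : ∀ y z → z ≈ p * y - q * (qi * (p * y - z))
    backward-step-correct y z = sym (≈-modulo-q*qi-1 (z - p * y)
      (solve 5 (λ p q qi y z → p :* y :- q :* (qi :* (p :* y :- z)) := z :+ (q :* qi :- con (+ 1)) :* (z :- p :* y))
             refl p q qi y z))

    lucasSeq-recurrent : ∀ x₀ x₁ → Recurrent (lucasSeq p q qi x₀ x₁)
    -- ℤ.suc (ℤ.suc k) computes only for k = + _, -[1+ 0 ], -[1+ 1 ] and -[1+ suc (suc _) ].
    lucasSeq-recurrent x₀ x₁ (+ k)              = refl
    lucasSeq-recurrent x₀ x₁ -[1+ 0 ]           = backward-step-correct _ _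
    lucasSeq-recurrent x₀ x₁ -[1+ 1 ]           = backward-step-correct _ _
    lucasSeq-recurrent x₀ x₁ -[1+ suc (suc m) ] = backward-step-correct _ _

    Recurrent-backward : ∀ {x} → Recurrent x → ∀ k → x k ≈ qi * (p * x (ℤ.suc k) - x (ℤ.suc (ℤ.suc k)))
    Recurrent-backward {x} rec k = begin
      x k                                                    ≈⟨ ≈-modulo-q*qi-1 (- x k)
        (solve 5 (λ p q qi y u → y := qi :* (p :* u :- (p :* u :- q :* y)) :+ (q :* qi :- con (+ 1)) :* (:- y))
               refl p q qi (x k) (x (ℤ.suc k))) ⟩
      qi * (p * x (ℤ.suc k) - (p * x (ℤ.suc k) - q * x k))  ≈⟨ *-congˡ (+-congˡ (-‿cong (rec k))) ⟨
      qi * (p * x (ℤ.suc k) - x (ℤ.suc (ℤ.suc k)))          ∎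

    Recurrent-unique : ∀ {x y} → Recurrent x → Recurrent y → x (+ 0) ≈ y (+ 0) → x (+ 1) ≈ y (+ 1) → ∀ k → x k ≈ y k
    Recurrent-unique {x} {y} rec-x rec-y x₀≈y₀ x₁≈y₁ = go
      where
      forward : ∀ k → x k ≈ y k → x (ℤ.suc k) ≈ y (ℤ.suc k) → x (ℤ.suc (ℤ.suc k)) ≈ y (ℤ.suc (ℤ.suc k))
      forward k eq eq′ = trans (rec-x k) (trans (+-cong (*-congˡ eq′) (-‿cong (*-congˡ eq))) (sym (rec-y k)))

      backward : ∀ k → x (ℤ.suc k) ≈ y (ℤ.suc k) → x (ℤ.suc (ℤ.suc k)) ≈ y (ℤ.suc (ℤ.suc k)) → x k ≈ y k
      backward k eq eq′ = trans (Recurrent-backward rec-x k)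
        (trans (*-congˡ (+-cong (*-congˡ eq) (-‿cong eq′))) (sym (Recurrent-backward rec-y k)))

      nonneg : ∀ n → x (+ n) ≈ y (+ n)
      nonneg 0             = x₀≈y₀
      nonneg 1             = x₁≈y₁
      nonneg (suc (suc n)) = forward (+ n) (nonneg n) (nonneg (suc n))

      neg : ∀ n → x -[1+ n ] ≈ y -[1+ n ]
      neg 0             = backward -[1+ 0 ] x₀≈y₀ x₁≈y₁
      neg 1             = backward -[1+ 1 ] (neg 0) x₀≈y₀
      neg (suc (suc n)) = backward -[1+ suc (suc n) ] (neg (suc n)) (neg n)

      go : ∀ k → x k ≈ y k
      go (+ n)    = nonneg n
      go -[1+ n ] = neg n

    Recurrent-∘ : ∀ {x} → Recurrent x → (e : ℤ → ℤ) → (∀ k → e (ℤ.suc k) ≡ ℤ.suc (e k)) → Recurrent (x ∘ e)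
    Recurrent-∘ {x} rec e e-suc k = begin
      x (e (ℤ.suc (ℤ.suc k)))            ≡⟨ cong x (≡-trans (e-suc (ℤ.suc k)) (cong ℤ.suc (e-suc k))) ⟩
      x (ℤ.suc (ℤ.suc (e k)))            ≈⟨ rec (e k) ⟩
      p * x (ℤ.suc (e k)) - q * x (e k)  ≡⟨ cong (λ i → p * x i - q * x (e k)) (e-suc k) ⟨
      p * x (e (ℤ.suc k)) - q * x (e k)  ∎

    Recurrent-shiftˡ : ∀ {x} → Recurrent x → ∀ a → Recurrent (λ k → x (a +ℤ k))
    Recurrent-shiftˡ rec a = Recurrent-∘ rec (a +ℤ_) (+-suc a)

    Recurrent-shiftʳ : ∀ {x} → Recurrent x → ∀ b → Recurrent (λ k → x (k +ℤ b))
    Recurrent-shiftʳ rec b = Recurrent-∘ rec (_+ℤ b) (λ k → ℤ.+-assoc (+ 1) k b)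

    Recurrent-linear : ∀ {x y} → Recurrent x → Recurrent y → ∀ α β → Recurrent (λ k → α * x k - β * y k)
    Recurrent-linear {x} {y} rec-x rec-y α β k =
      trans (+-cong (*-congˡ (rec-x k)) (-‿cong (*-congˡ (rec-y k))))
        (solve 8 (λ α β p q x₁ x₀ y₁ y₀ → α :* (p :* x₁ :- q :* x₀) :- β :* (p :* y₁ :- q :* y₀)
                                          := p :* (α :* x₁ :- β :* y₁) :- q :* (α :* x₀ :- β :* y₀))
               refl α β p q (x (ℤ.suc k)) (x k) (y (ℤ.suc k)) (y k))

    Recurrent-resp : ∀ {x y} → (∀ k → x k ≈ y k) → Recurrent x → Recurrent y
    Recurrent-resp x≈y rec k =
      trans (sym (x≈y _)) (trans (rec k) (+-cong (*-congˡ (x≈y _)) (-‿cong (*-congˡ (x≈y _)))))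

    Recurrent-reflect : ∀ {x} → Recurrent x → ∀ a b → Recurrent (λ k → q^ (a +ℤ k) * x (b -ℤ k))
    Recurrent-reflect {x} rec a b k = begin
      q^ (a +ℤ ℤ.suc (ℤ.suc k)) * x m
        ≡⟨ cong (λ i → q^ i * x m) (≡-trans (+-suc a (ℤ.suc k)) (cong ℤ.suc (+-suc a k))) ⟩
      q^ ℤ.suc (ℤ.suc T) * x m
        ≈⟨ *-congʳ (trans (q^-suc (ℤ.suc T)) (*-congʳ (q^-suc T))) ⟩
      q^ T * q * q * x m
        ≈⟨ solve 5 (λ p q y x₁ x₀ → y :* q :* q :* x₀ := p :* (y :* q :* x₁) :- q :* (y :* (p :* x₁ :- q :* x₀)))
                 refl p q (q^ T) (x (ℤ.suc m)) (x m) ⟩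
      p * (q^ T * q * x (ℤ.suc m)) - q * (q^ T * (p * x (ℤ.suc m) - q * x m))
        ≈⟨ +-cong (*-congˡ (*-congʳ (q^-suc T))) (-‿cong (*-congˡ (*-congˡ (rec m)))) ⟨
      p * (q^ ℤ.suc T * x (ℤ.suc m)) - q * (q^ T * x (ℤ.suc (ℤ.suc m)))
        ≡⟨ cong₂ (λ i j → p * (q^ i * x j) - q * (q^ T * x (ℤ.suc j))) (+-suc a k) (sub-suc b (ℤ.suc k)) ⟨
      p * (q^ (a +ℤ ℤ.suc k) * x (b -ℤ ℤ.suc k)) - q * (q^ T * x (ℤ.suc (b -ℤ ℤ.suc k)))
        ≡⟨ cong (λ j → p * (q^ (a +ℤ ℤ.suc k) * x (b -ℤ ℤ.suc k)) - q * (q^ T * x j)) (sub-suc b k) ⟨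
      p * (q^ (a +ℤ ℤ.suc k) * x (b -ℤ ℤ.suc k)) - q * (q^ T * x (b -ℤ k))
        ∎
      where
      T m : ℤ
      T = a +ℤ k
      m = b -ℤ ℤ.suc (ℤ.suc k)

    cassini : (ℤ → Carrier) → ℤ → Carrier
    cassini x k = x (ℤ.suc k) * x (ℤ.suc k) - x k * x (ℤ.suc (ℤ.suc k))

    cassini-geometric : ∀ {x} → Recurrent x → ∀ k → cassini x k ≈ q^ k * cassini x (+ 0)
    cassini-geometric {x} rec = geometric cassini-step
      where
      cassini-step : ∀ k → cassini x (ℤ.suc k) ≈ q * cassini x k
      cassini-step k = begin
        x₂ * x₂ - x₁ * x (ℤ.suc (ℤ.suc (ℤ.suc k)))
          ≈⟨ +-congˡ (-‿cong (*-congˡ (trans (rec (ℤ.suc k)) (+-congʳ (*-congˡ (rec k)))))) ⟩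
        x₂ * x₂ - x₁ * (p * (p * x₁ - q * x₀) - q * x₁)
          ≈⟨ +-congʳ (*-cong (rec k) (rec k)) ⟩
        (p * x₁ - q * x₀) * (p * x₁ - q * x₀) - x₁ * (p * (p * x₁ - q * x₀) - q * x₁)
          ≈⟨ solve 4 (λ p q x₀ x₁ → (p :* x₁ :- q :* x₀) :* (p :* x₁ :- q :* x₀) :- x₁ :* (p :* (p :* x₁ :- q :* x₀) :- q :* x₁)
                                    := q :* (x₁ :* x₁ :- x₀ :* (p :* x₁ :- q :* x₀)))
                   refl p q x₀ x₁ ⟩
        q * (x₁ * x₁ - x₀ * (p * x₁ - q * x₀))
          ≈⟨ *-congˡ (+-congˡ (-‿cong (*-congˡ (rec k)))) ⟨
        q * cassini x k
          ∎
        where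
        x₀ x₁ x₂ : Carrier
        x₀ = x k
        x₁ = x (ℤ.suc k)
        x₂ = x (ℤ.suc (ℤ.suc k))

    Recurrent₂-unique : ∀ {x y : ℤ → ℤ → Carrier} →
      (∀ s → Recurrent (x s)) → (∀ t → Recurrent (λ s → x s t)) →
      (∀ s → Recurrent (y s)) → (∀ t → Recurrent (λ s → y s t)) →
      x (+ 0) (+ 0) ≈ y (+ 0) (+ 0) → x (+ 0) (+ 1) ≈ y (+ 0) (+ 1) →
      x (+ 1) (+ 0) ≈ y (+ 1) (+ 0) → x (+ 1) (+ 1) ≈ y (+ 1) (+ 1) →
      ∀ s t → x s t ≈ y s t
    Recurrent₂-unique rec-xₜ rec-xₛ rec-yₜ rec-yₛ e₀₀ e₀₁ e₁₀ e₁₁ s =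
      Recurrent-unique (rec-xₜ s) (rec-yₜ s)
        (Recurrent-unique (rec-xₛ (+ 0)) (rec-yₛ (+ 0)) e₀₀ e₁₀ s)
        (Recurrent-unique (rec-xₛ (+ 1)) (rec-yₛ (+ 1)) e₀₁ e₁₁ s)

module ProductDifference {c ℓ : Level} (R : CommutativeRing c ℓ) where
  open CommutativeRing R
  open Horadam R
  open IntegerCoefficientSolver R using (solve; _:=_; _:+_; _:*_; _:-_; con)
  open import Relation.Binary.Reasoning.Setoid setoid

  module _ (p q qi : Carrier) (q*qi≈1 : q * qi ≈ 1#) (a b : Carrier) (n : ℤ) where
    open Recurrence.Solutions R p q qi q*qi≈1

    private
      H V : ℤ → Carrier
      H = h a b p q qi
      V = v p q qi

      H-recurrent : Recurrent H
      H-recurrent = lucasSeq-recurrent _ _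

      V-recurrent : Recurrent V
      V-recurrent = lucasSeq-recurrent _ _

    productDifference : ℤ → ℤ → Carrier
    productDifference s t = H (n +ℤ s) * H (n +ℤ t) - H n * H (n +ℤ t +ℤ s)

    closedForm : ℤ → ℤ → Carrier
    closedForm s t = E a b p q * q^ (n +ℤ t) * (V (s -ℤ t) - q^ s * V (-ℤ t -ℤ s))

    productDifference-recurrentₜ : ∀ s → Recurrent (productDifference s)
    productDifference-recurrentₜ s =
      Recurrent-linear (Recurrent-shiftˡ H-recurrent n)
                       (Recurrent-shiftˡ (Recurrent-shiftʳ H-recurrent s) n) (H (n +ℤ s)) (H n)

    productDifference-recurrentₛ : ∀ t → Recurrent (λ s → productDifference s t)
    productDifference-recurrentₛ t = Recurrent-resp (λ s → +-congʳ (*-comm _ _))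
      (Recurrent-linear (Recurrent-shiftˡ H-recurrent n)
                        (Recurrent-shiftˡ H-recurrent (n +ℤ t)) (H (n +ℤ t)) (H n))

    closedForm-recurrentₜ : ∀ s → Recurrent (closedForm s)
    closedForm-recurrentₜ s = Recurrent-resp regroup
      (Recurrent-linear (Recurrent-reflect V-recurrent n s)
                        (Recurrent-reflect V-recurrent n (-ℤ s)) (E a b p q) (E a b p q * q^ s))
      where
      regroup : ∀ t → E a b p q * (q^ (n +ℤ t) * V (s -ℤ t)) - E a b p q * q^ s * (q^ (n +ℤ t) * V (-ℤ s -ℤ t))
                      ≈ closedForm s t
      regroup t = trans (+-congˡ (-‿cong (*-congˡ (*-congˡ (reflexive (cong V (ℤ.+-comm (-ℤ s) (-ℤ t))))))))
        (solve 5 (λ e y x z x′ → e :* (y :* x) :- e :* z :* (y :* x′) := e :* y :* (x :- z :* x′))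
               refl (E a b p q) (q^ (n +ℤ t)) (V (s -ℤ t)) (q^ s) (V (-ℤ t -ℤ s)))

    closedForm-recurrentₛ : ∀ t → Recurrent (λ s → closedForm s t)
    closedForm-recurrentₛ t = Recurrent-resp regroup
      (Recurrent-linear (Recurrent-shiftʳ V-recurrent (-ℤ t))
                        (Recurrent-reflect V-recurrent (+ 0) (-ℤ t)) scale scale)
      where
      scale : Carrier
      scale = E a b p q * q^ (n +ℤ t)
      regroup : ∀ s → scale * V (s -ℤ t) - scale * (q^ (+ 0 +ℤ s) * V (-ℤ t -ℤ s)) ≈ closedForm s t
      regroup s = trans (+-congˡ (-‿cong (*-congˡ (*-congʳ (reflexive (cong q^_ (ℤ.+-identityˡ s)))))))
        (solve 3 (λ c x y → c :* x :- c :* y := c :* (x :- y)) refl scale (V (s -ℤ t)) (q^ s * V (-ℤ t -ℤ s)))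

    productDifference≈closedForm₀ : ∀ t → productDifference (+ 0) t ≈ closedForm (+ 0) t
    productDifference≈closedForm₀ t = begin
      H (n +ℤ + 0) * H (n +ℤ t) - H n * H (n +ℤ t +ℤ + 0)
        ≡⟨ cong₂ (λ i j → H i * H (n +ℤ t) - H n * H j) (ℤ.+-identityʳ n) (ℤ.+-identityʳ (n +ℤ t)) ⟩
      H n * H (n +ℤ t) - H n * H (n +ℤ t)
        ≈⟨ solve 4 (λ x y c w → x :* y :- x :* y := c :* (w :- con (+ 1) :* w))
                 refl (H n) (H (n +ℤ t)) (E a b p q * q^ (n +ℤ t)) (V (-ℤ t)) ⟩
      E a b p q * q^ (n +ℤ t) * (V (-ℤ t) - 1# * V (-ℤ t))
        ≡⟨ cong₂ (λ i j → E a b p q * q^ (n +ℤ t) * (V i - 1# * V j)) (ℤ.+-identityˡ (-ℤ t)) (ℤ.+-identityʳ (-ℤ t)) ⟨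
      closedForm (+ 0) t
        ∎

    productDifference≈closedForm₁₀ : productDifference (+ 1) (+ 0) ≈ closedForm (+ 1) (+ 0)
    productDifference≈closedForm₁₀ rewrite ℤ.+-identityʳ n = ≈-modulo-q*qi-1 (E a b p q * q^ n * p)
      (solve 6 (λ x y c p q qi → y :* x :- x :* y
                                 := c :* (p :- con (+ 1) :* q :* (qi :* (p :* (con (+ 1) :+ con (+ 1)) :- p)))
                                    :+ (q :* qi :- con (+ 1)) :* (c :* p))
             refl (H n) (H (n +ℤ + 1)) (E a b p q * q^ n) p q qi)

    cassini-h₀ : cassini H (+ 0) ≈ E a b p q * ((1# + 1# + 1# + 1#) * q - p * p)
    cassini-h₀ = solve 4 (λ a b p q →
      let two = con (+ 1) :+ con (+ 1)
          h₀  = two :* b :- a :* p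
          h₁  = b :* p :- two :* (a :* q)
      in  h₁ :* h₁ :- h₀ :* (p :* h₁ :- q :* h₀)
          := (b :* b :- a :* b :* p :+ a :* a :* q) :* ((two :+ con (+ 1) :+ con (+ 1)) :* q :- p :* p))
      refl a b p q

    q*[v₀-q*v₋₂] : q * (V (+ 0) - q^ (+ 1) * V -[1+ 1 ]) ≈ (1# + 1# + 1# + 1#) * q - p * p
    q*[v₀-q*v₋₂] = ≈-modulo-q*qi-1 ((1# + 1#) * q - p * p * (q * qi + 1#)) (solve 3 (λ p q qi →
      let two = con (+ 1) :+ con (+ 1)
      in  q :* (two :- con (+ 1) :* q :* (qi :* (p :* (qi :* (p :* two :- p)) :- two)))
          := (two :+ con (+ 1) :+ con (+ 1)) :* q :- p :* p
             :+ (q :* qi :- con (+ 1)) :* (two :* q :- p :* p :* (q :* qi :+ con (+ 1))))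
      refl p q qi)

    productDifference≈closedForm₁₁ : productDifference (+ 1) (+ 1) ≈ closedForm (+ 1) (+ 1)
    productDifference≈closedForm₁₁ rewrite ℤ.+-comm n (+ 1) | ℤ.+-comm (ℤ.suc n) (+ 1) = begin
      cassini H n                                                ≈⟨ cassini-geometric H-recurrent n ⟩
      q^ n * cassini H (+ 0)                                     ≈⟨ *-congˡ cassini-h₀ ⟩
      q^ n * (E a b p q * ((1# + 1# + 1# + 1#) * q - p * p))     ≈⟨ *-congˡ (*-congˡ q*[v₀-q*v₋₂]) ⟨
      q^ n * (E a b p q * (q * w))                               ≈⟨ solve 4 (λ y e q w → y :* (e :* (q :* w)) := e :* (y :* q) :* w)
                                                                          refl (q^ n) (E a b p q) q w ⟩
      E a b p q * (q^ n * q) * w                                 ≈⟨ *-congʳ (*-congˡ (q^-suc n)) ⟨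
      E a b p q * q^ ℤ.suc n * w                                 ∎
      where
      w : Carrier
      w = V (+ 0) - q^ (+ 1) * V -[1+ 1 ]

    productDifference≈closedForm : ∀ s t → productDifference s t ≈ closedForm s t
    productDifference≈closedForm =
      Recurrent₂-unique productDifference-recurrentₜ productDifference-recurrentₛ
                        closedForm-recurrentₜ closedForm-recurrentₛ
                        (productDifference≈closedForm₀ (+ 0)) (productDifference≈closedForm₀ (+ 1))
                        productDifference≈closedForm₁₀ productDifference≈closedForm₁₁

mainTheorem8 : ∀ {c ℓ : Level} (R : CommutativeRing c ℓ) → let open CommutativeRing R
                                                               open Horadam R in
  ∀ (a b p q qi : Carrier) → q * qi ≈ 1# →
  ∀ (n r s : ℤ) →
    h a b p q qi (n +ℤ s) * h a b p q qi (n -ℤ r) - h a b p q qi n * h a b p q qi (n -ℤ r +ℤ s)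
      ≈ E a b p q * zpow q qi (n -ℤ r) * (v p q qi (r +ℤ s) - zpow q qi s * v p q qi (r -ℤ s))
mainTheorem8 R a b p q qi q*qi≈1 n r s =
  trans (productDifference≈closedForm p q qi q*qi≈1 a b n s (-ℤ r))
        (reflexive (cong₂ (λ i j → E a b p q * zpow q qi (n -ℤ r) * (v p q qi i - zpow q qi s * v p q qi j))
                          (≡-trans (cong (s +ℤ_) (ℤ.neg-involutive r)) (ℤ.+-comm s r))
                          (cong (_-ℤ s) (ℤ.neg-involutive r))))
  where
  open CommutativeRing R
  open Horadam R
  open ProductDifference R
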